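{- Let $G$ be a finite simple graph. Then $G$ has no edge if and only if its chromatic symmetric function $X_G$ belongs to $\Gamma$.
   Context: For a finite simple graph $G=(V,E)$ with $V=\{v_1,\dots,v_n\}$, a proper coloring is a map $\kappa:V\to\{1,2,\dots\}$ with $\kappa(v_i)\neq\kappa(v_j)$ whenever $\{v_i,v_j\}\in E$. The chromatic symmetric function is $X_G=\sum_{\kappa}x_{\kappa(v_1)}\cdots x_{\kappa(v_n)}$, the sum over all proper colorings. $p_r=\sum_i x_i^r$ denotes the $r$th power sum symmetric function, and $\Gamma=\mathbb{Q}[p_1,p_3,p_5,\dots]$ is the subalgebra of the algebra of symmetric functions generated by the odd power sums. -}

module Defs where

open import Data.Nat using (ℕ; zero; suc; _+_; _*_; _≡ᵇ_)
open import Data.Nat.DivMod using (_%_)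
open import Data.Fin using (Fin; zero; suc; _≟_)
open import Data.Bool using (Bool; true; false; _∧_; not; if_then_else_)
open import Data.List using (List; []; _∷_; [_]; map; concatMap; length; lookup; allFin; foldr)
open import Data.List.Relation.Unary.All using (All)
open import Data.Product using (Σ; _×_; _,_; proj₁; proj₂)
open import Data.Integer using (+_)
open import Data.Rational using (ℚ; _/_) renaming (_+_ to _+ℚ_; _*_ to _*ℚ_)
open import Relation.Nullary.Decidable using (⌊_⌋)
open import Relation.Binary.PropositionalEquality using (_≡_)

record SimpleGraph (n : ℕ) : Set where
  field
    adj    : Fin n → Fin n → Bool
    sym    : ∀ i j → adj i j ≡ adj j i
    irrefl : ∀ i → adj i i ≡ false
open SimpleGraph public

NoEdge : ∀ {n} → SimpleGraph n → Set
NoEdge G = ∀ i j → adj G i j ≡ false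

sumFin : (n : ℕ) → (Fin n → ℕ) → ℕ
sumFin zero    f = 0
sumFin (suc n) f = f zero + sumFin n (λ i → f (suc i))

andFin : (n : ℕ) → (Fin n → Bool) → Bool
andFin zero    f = true
andFin (suc n) f = f zero ∧ andFin n (λ i → f (suc i))

cons : ∀ {n k} → Fin k → (Fin n → Fin k) → Fin (suc n) → Fin k
cons c f zero    = c
cons c f (suc i) = f i

funs : (n k : ℕ) → List (Fin n → Fin k)
funs zero    k = [ (λ ()) ]
funs (suc n) k = concatMap (λ f → map (λ c → cons c f) (allFin k)) (funs n k)

countTrue : ∀ {A : Set} → (A → Bool) → List A → ℕ
countTrue p []       = 0
countTrue p (x ∷ xs) = (if p x then 1 else 0) + countTrue p xs

-- Monomials x_1^{α_0} x_2^{α_1} ... x_k^{α_{k-1}} are encoded by exponent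
-- lists α : List ℕ (all variables beyond the list have exponent 0).
-- A symmetric function (formal power series in x_1, x_2, ...) is
-- represented by its coefficient function List ℕ → ℚ.

-- Given weights w on Fin ℓ and an assignment f : Fin ℓ → Fin k of
-- "colours", does the monomial ∏_j x_{f j}^{w j} equal x^α (k = length α)?
matches : ∀ {ℓ} (w : Fin ℓ → ℕ) (α : List ℕ) → (Fin ℓ → Fin (length α)) → Bool
matches {ℓ} w α f =
  andFin (length α) (λ i → sumFin ℓ (λ j → if ⌊ f j ≟ i ⌋ then w j else 0) ≡ᵇ lookup α i)

proper : ∀ {n k} → SimpleGraph n → (Fin n → Fin k) → Bool
proper {n} G κ = andFin n (λ i → andFin n (λ j → not (adj G i j ∧ ⌊ κ i ≟ κ j ⌋)))

toℚ : ℕ → ℚ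
toℚ m = (+ m) / 1

-- Coefficient of x^α in X_G = Σ_κ x_{κ(v_1)} ⋯ x_{κ(v_n)}
-- (proper colourings using only colours 1..length α).
X : ∀ {n} → SimpleGraph n → List ℕ → ℚ
X {n} G α = toℚ (countTrue (λ κ → proper G κ ∧ matches (λ _ → 1) α κ) (funs n (length α)))

-- Coefficient of x^α in p_λ = ∏_j p_{λ_j}, p_r = Σ_i x_i^r.
p : List ℕ → List ℕ → ℚ
p λs α = toℚ (countTrue (matches (lookup λs) α) (funs (length λs) (length α)))

Odd : ℕ → Set
Odd m = m % 2 ≡ 1

-- Γ = ℚ[p_1, p_3, p_5, ...]: finite ℚ-linear combinations of products
-- p_λ of odd power sums (λ a list of odd parts; the empty product is 1).
InΓ : (List ℕ → ℚ) → Set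
InΓ F = Σ (List (ℚ × List ℕ)) λ terms →
          All (λ t → All Odd (proj₂ t)) terms ×
          (∀ α → F α ≡ foldr (λ t acc → (proj₁ t *ℚ p (proj₂ t) α) +ℚ acc) (toℚ 0) terms)

module Submission where

-- (⇒) Without edges every colouring is proper, so X_G = p₁ⁿ ∈ Γ.
-- (⇐) Every F ∈ Γ cancels: [x₁² x^β] F + [x₂² x^β] F = [x₁x₂ x^β] F for each
-- tail β, the t²-part of F(t, -t, x₃, …) = F(0, 0, x₃, …).  For odd power sum
-- products this is an induction on the factors (coeff-suc, OddFactor), and it
-- extends to Γ linearly.  Since p₁ⁿ cancels and agrees with X_G on squarefree
-- exponents, cancellation of X_G at a squarefree β makes every colouring of
-- content (2, 0, β) proper; for an edge uv, colouring u, v with colour zero and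
-- the other vertices distinctly contradicts this (EdgeWitness).

open import Defs hiding (sym)
open import Data.Nat using (ℕ; zero; suc; _+_; _∸_; _≤_; _≤ᵇ_; _≡ᵇ_; z≤n; s≤s)
open import Data.Nat.Properties
  using ( +-identityʳ; +-comm; +-assoc; +-suc; ≤-refl; ≤-trans; m≤m+n; m≤n+m; +-monoʳ-≤
        ; +-cancelˡ-≡; m+n≡0⇒m≡0; ≡ᵇ⇒≡; ≡⇒≡ᵇ; +-commutativeSemigroup)
open import Data.Nat.ListAction using (sum)
open import Data.Nat.Coprimality using (Coprime)
open import Data.Nat.Divisibility using (∣1⇒≡1)
import Data.Integer as ℤ
import Data.Integer.Properties as ℤ
open import Data.Rational using (ℚ; mkℚ; _/_) renaming (_+_ to _+ℚ_; _*_ to _*ℚ_)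
import Data.Rational.Properties as ℚP
open import Data.Fin using (Fin; zero; suc; _≟_; cast)
open import Data.Fin.Properties using (cast-involutive)
open import Data.Bool using (Bool; true; false; _∧_; _∨_; not; if_then_else_)
open import Data.Bool.Properties using (∧-assoc; ∧-comm; ∧-zeroʳ; ∧-identityʳ; ∨-zeroʳ; T-≡)
open import Data.List using (List; []; _∷_; _++_; map; concatMap; tabulate; allFin; length; lookup; replicate; foldr)
open import Data.List.Properties using (map-cong; length-tabulate; lookup-tabulate)
open import Data.List.Relation.Unary.All using (All; []; _∷_)
open import Data.List.Relation.Unary.Any using (Any; here; there)
import Data.List.Relation.Unary.Any as Any
open import Data.List.Relation.Unary.Any.Properties using (concatMap⁺; map⁺; tabulate⁺)
open import Data.Product using (_×_; _,_; proj₁; proj₂)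
open import Data.Empty using (⊥-elim)
open import Relation.Nullary using (¬_)
open import Relation.Nullary.Decidable using (⌊_⌋; yes; no)
open import Relation.Binary.PropositionalEquality
open import Function.Bundles using (_⇔_; mk⇔; module Equivalence)
open import Algebra.Bundles using (CommutativeMonoid)
open import Algebra.Properties.CommutativeSemigroup +-commutativeSemigroup
  using () renaming (interchange to +-interchange)
open import Algebra.Properties.CommutativeSemigroup (CommutativeMonoid.commutativeSemigroup ℚP.+-0-commutativeMonoid)
  using () renaming (interchange to +ℚ-interchange)

𝟙 : Bool → ℕ
𝟙 b = if b then 1 else 0

sumFin-cong : ∀ n {f g : Fin n → ℕ} → (∀ i → f i ≡ g i) → sumFin n f ≡ sumFin n g
sumFin-cong zero    eq = refl
sumFin-cong (suc n) eq = cong₂ _+_ (eq zero) (sumFin-cong n (λ i → eq (suc i)))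

sumFin-+ : ∀ n (f g : Fin n → ℕ) → sumFin n (λ i → f i + g i) ≡ sumFin n f + sumFin n g
sumFin-+ zero    f g = refl
sumFin-+ (suc n) f g =
  trans (cong (f zero + g zero +_) (sumFin-+ n (λ i → f (suc i)) (λ i → g (suc i))))
        (+-interchange (f zero) (g zero) _ _)

sumFin-zero : ∀ n → sumFin n (λ _ → 0) ≡ 0
sumFin-zero zero    = refl
sumFin-zero (suc n) = sumFin-zero n

suc≟suc : ∀ {k} (c i : Fin k) → ⌊ suc c ≟ suc i ⌋ ≡ ⌊ c ≟ i ⌋
suc≟suc c i with c ≟ i
... | yes _ = refl
... | no  _ = refl

≟-refl : ∀ {k} (x : Fin k) → ⌊ x ≟ x ⌋ ≡ true
≟-refl x with x ≟ x
... | yes _  = refl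
... | no x≢x = ⊥-elim (x≢x refl)

≟-≢ : ∀ {k} {x y : Fin k} → ¬ x ≡ y → ⌊ x ≟ y ⌋ ≡ false
≟-≢ {x = x} {y} x≢y with x ≟ y
... | yes x≡y = ⊥-elim (x≢y x≡y)
... | no  _   = refl

≟-≡ : ∀ {k} {x y : Fin k} → ⌊ x ≟ y ⌋ ≡ true → x ≡ y
≟-≡ {x = x} {y} eq with x ≟ y
≟-≡ eq | yes x≡y = x≡y

sumFin-point : ∀ n (i : Fin n) x → sumFin n (λ j → if ⌊ j ≟ i ⌋ then x else 0) ≡ x
sumFin-point (suc n) zero    x = trans (cong (x +_) (sumFin-zero n)) (+-identityʳ x)
sumFin-point (suc n) (suc i) x =
  trans (sumFin-cong n (λ j → cong (λ b → if b then x else 0) (suc≟suc j i))) (sumFin-point n i x)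

term≤sumFin : ∀ n (h : Fin n → ℕ) i → h i ≤ sumFin n h
term≤sumFin (suc n) h zero    = m≤m+n (h zero) _
term≤sumFin (suc n) h (suc i) = ≤-trans (term≤sumFin n (λ j → h (suc j)) i) (m≤n+m _ (h zero))

twoTerms≤sumFin : ∀ n (h : Fin n → ℕ) {i j} → ¬ i ≡ j → h i + h j ≤ sumFin n h
twoTerms≤sumFin (suc n) h {zero}  {zero}  i≢j = ⊥-elim (i≢j refl)
twoTerms≤sumFin (suc n) h {zero}  {suc j} i≢j = +-monoʳ-≤ (h zero) (term≤sumFin n (λ j → h (suc j)) j)
twoTerms≤sumFin (suc n) h {suc i} {zero}  i≢j =
  subst (_≤ sumFin (suc n) h) (+-comm (h zero) (h (suc i)))
        (+-monoʳ-≤ (h zero) (term≤sumFin n (λ j → h (suc j)) i))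
twoTerms≤sumFin (suc n) h {suc i} {suc j} i≢j =
  ≤-trans (twoTerms≤sumFin n (λ j → h (suc j)) (λ i≡j → i≢j (cong suc i≡j))) (m≤n+m _ (h zero))

andFin-cong : ∀ n {f g : Fin n → Bool} → (∀ i → f i ≡ g i) → andFin n f ≡ andFin n g
andFin-cong zero    eq = refl
andFin-cong (suc n) eq = cong₂ _∧_ (eq zero) (andFin-cong n (λ i → eq (suc i)))

andFin-true : ∀ n {f : Fin n → Bool} → (∀ i → f i ≡ true) → andFin n f ≡ true
andFin-true zero    eq = refl
andFin-true (suc n) eq rewrite eq zero = andFin-true n (λ i → eq (suc i))

andFin-true⁻¹ : ∀ n (f : Fin n → Bool) → andFin n f ≡ true → ∀ i → f i ≡ true
andFin-true⁻¹ (suc n) f eq i with f zero in f0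
andFin-true⁻¹ (suc n) f eq zero    | true = f0
andFin-true⁻¹ (suc n) f eq (suc i) | true = andFin-true⁻¹ n (λ i → f (suc i)) eq i

andFin-false : ∀ n (f : Fin n → Bool) i → f i ≡ false → andFin n f ≡ false
andFin-false (suc n) f zero    eq rewrite eq = refl
andFin-false (suc n) f (suc i) eq with f zero
... | true  = andFin-false n (λ i → f (suc i)) i eq
... | false = refl

andFin-extract : ∀ k (c : Fin k) P (h : Fin k → Bool) →
  andFin k (λ i → (if ⌊ c ≟ i ⌋ then P else true) ∧ h i) ≡ P ∧ andFin k h
andFin-extract (suc k) zero    P h = ∧-assoc P (h zero) _
andFin-extract (suc k) (suc c) P h = begin
  h zero ∧ andFin k (λ i → (if ⌊ suc c ≟ suc i ⌋ then P else true) ∧ h (suc i))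
    ≡⟨ cong (h zero ∧_) (andFin-cong k (λ i → cong (λ b → (if b then P else true) ∧ h (suc i)) (suc≟suc c i))) ⟩
  h zero ∧ andFin k (λ i → (if ⌊ c ≟ i ⌋ then P else true) ∧ h (suc i))
    ≡⟨ cong (h zero ∧_) (andFin-extract k c P (λ i → h (suc i))) ⟩
  h zero ∧ (P ∧ andFin k (λ i → h (suc i)))
    ≡⟨ sym (∧-assoc (h zero) P _) ⟩
  (h zero ∧ P) ∧ andFin k (λ i → h (suc i))
    ≡⟨ cong (_∧ andFin k (λ i → h (suc i))) (∧-comm (h zero) P) ⟩
  (P ∧ h zero) ∧ andFin k (λ i → h (suc i))
    ≡⟨ ∧-assoc P (h zero) _ ⟩
  P ∧ andFin (suc k) h
    ∎
  where open ≡-Reasoning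

countTrue-cong : ∀ {A : Set} {p q : A → Bool} → (∀ x → p x ≡ q x) → ∀ xs → countTrue p xs ≡ countTrue q xs
countTrue-cong eq []       = refl
countTrue-cong eq (x ∷ xs) = cong₂ _+_ (cong 𝟙 (eq x)) (countTrue-cong eq xs)

countTrue-++ : ∀ {A : Set} (p : A → Bool) xs ys → countTrue p (xs ++ ys) ≡ countTrue p xs + countTrue p ys
countTrue-++ p []       ys = refl
countTrue-++ p (x ∷ xs) ys = trans (cong (𝟙 (p x) +_) (countTrue-++ p xs ys)) (sym (+-assoc (𝟙 (p x)) _ _))

countTrue-concatMap : ∀ {A B : Set} (p : B → Bool) (g : A → List B) xs →
  countTrue p (concatMap g xs) ≡ sum (map (λ x → countTrue p (g x)) xs)
countTrue-concatMap p g []       = refl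
countTrue-concatMap p g (x ∷ xs) =
  trans (countTrue-++ p (g x) (concatMap g xs)) (cong (countTrue p (g x) +_) (countTrue-concatMap p g xs))

countTrue-map-tabulate : ∀ {A B : Set} (p : B → Bool) (h : A → B) k (g : Fin k → A) →
  countTrue p (map h (tabulate g)) ≡ sumFin k (λ c → 𝟙 (p (h (g c))))
countTrue-map-tabulate p h zero    g = refl
countTrue-map-tabulate p h (suc k) g = cong (𝟙 (p (h (g zero))) +_) (countTrue-map-tabulate p h k (λ i → g (suc i)))

countTrue-exchange : ∀ {A : Set} k (q : Fin k → A → Bool) xs →
  sum (map (λ x → sumFin k (λ c → 𝟙 (q c x))) xs) ≡ sumFin k (λ c → countTrue (q c) xs)
countTrue-exchange k q []       = sym (sumFin-zero k)
countTrue-exchange k q (x ∷ xs) =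
  trans (cong (sumFin k (λ c → 𝟙 (q c x)) +_) (countTrue-exchange k q xs))
        (sym (sumFin-+ k (λ c → 𝟙 (q c x)) (λ c → countTrue (q c) xs)))

countTrue-guard : ∀ {A : Set} g (h : A → Bool) xs → countTrue (λ x → g ∧ h x) xs ≡ (if g then countTrue h xs else 0)
countTrue-guard true  h xs       = refl
countTrue-guard false h []       = refl
countTrue-guard false h (x ∷ xs) = countTrue-guard false h xs

countTrue-split : ∀ {A : Set} (P M : A → Bool) xs →
  countTrue M xs ≡ countTrue (λ x → P x ∧ M x) xs + countTrue (λ x → not (P x) ∧ M x) xs
countTrue-split P M []       = refl
countTrue-split P M (x ∷ xs) rewrite countTrue-split P M xs with P x | M x
... | true  | true  = refl
... | true  | false = refl
... | false | true  = sym (+-suc (countTrue (λ x → P x ∧ M x) xs) _)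
... | false | false = refl

countTrue-pos : ∀ {A : Set} (p : A → Bool) xs → Any (λ x → p x ≡ true) xs → 1 ≤ countTrue p xs
countTrue-pos p (x ∷ xs) (here px) rewrite px = s≤s z≤n
countTrue-pos p (x ∷ xs) (there w) = ≤-trans (countTrue-pos p xs w) (m≤n+m _ (𝟙 (p x)))

funs-complete : ∀ n k (κ : Fin n → Fin k) → Any (λ f → ∀ i → f i ≡ κ i) (funs n k)
funs-complete zero    k κ = here (λ ())
funs-complete (suc n) k κ =
  concatMap⁺ (λ f → map (λ c → cons c f) (allFin k)) (Any.map extend (funs-complete n k (λ i → κ (suc i))))
  where
  extend : ∀ {f} → (∀ i → f i ≡ κ (suc i)) → Any (λ f′ → ∀ i → f′ i ≡ κ i) (map (λ c → cons c f) (allFin k))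
  extend {f} f≗ = map⁺ (tabulate⁺ (κ zero) agree)
    where
    agree : ∀ i → cons (κ zero) f i ≡ κ i
    agree zero    = refl
    agree (suc i) = f≗ i

-- The weighted colour content of f at colour i: the total weight of the
-- points coloured i.  The monomial ∏_j x_{f j}^{w j} is x^{content w f}.
content : ∀ {ℓ k} (w : Fin ℓ → ℕ) → (Fin ℓ → Fin k) → Fin k → ℕ
content {ℓ} w f i = sumFin ℓ (λ j → if ⌊ f j ≟ i ⌋ then w j else 0)

hasContent : ∀ {ℓ k} (w : Fin ℓ → ℕ) (a : Fin k → ℕ) → (Fin ℓ → Fin k) → Bool
hasContent {k = k} w a f = andFin k (λ i → content w f i ≡ᵇ a i)

-- coeff ℓ k w a counts the f : Fin ℓ → Fin k of content a, i.e. it is the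
-- coefficient of x^a in the product of power sums ∏_j p_{w j}.  In
-- particular p λs α = toℚ (coeff (length λs) (length α) (lookup λs) (lookup α)).
coeff : (ℓ k : ℕ) → (Fin ℓ → ℕ) → (Fin k → ℕ) → ℕ
coeff ℓ k w a = countTrue (hasContent w a) (funs ℓ k)

lower : ∀ {k} → Fin k → ℕ → (Fin k → ℕ) → Fin k → ℕ
lower c v a i = if ⌊ c ≟ i ⌋ then a i ∸ v else a i

hasContent-cong : ∀ {ℓ k} (w : Fin ℓ → ℕ) {a b : Fin k → ℕ} (f : Fin ℓ → Fin k) →
  (∀ i → a i ≡ b i) → hasContent w a f ≡ hasContent w b f
hasContent-cong {k = k} w f a≗b = andFin-cong k (λ i → cong (content w f i ≡ᵇ_) (a≗b i))

hasContent-ext : ∀ {ℓ k} (w : Fin ℓ → ℕ) (a : Fin k → ℕ) {f g : Fin ℓ → Fin k} →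
  (∀ j → f j ≡ g j) → hasContent w a f ≡ hasContent w a g
hasContent-ext {ℓ} {k} w a f≗g =
  andFin-cong k (λ i → cong (_≡ᵇ a i) (sumFin-cong ℓ (λ j → cong (λ x → if ⌊ x ≟ i ⌋ then w j else 0) (f≗g j))))

coeff-cong : ∀ ℓ k (w : Fin ℓ → ℕ) {a b : Fin k → ℕ} → (∀ i → a i ≡ b i) → coeff ℓ k w a ≡ coeff ℓ k w b
coeff-cong ℓ k w a≗b = countTrue-cong (λ f → hasContent-cong w f a≗b) (funs ℓ k)

+≡ᵇ-split : ∀ x s a → ((x + s) ≡ᵇ a) ≡ ((x ≤ᵇ a) ∧ (s ≡ᵇ (a ∸ x)))
+≡ᵇ-split zero          s a       = refl
+≡ᵇ-split (suc x)       s zero    = refl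
+≡ᵇ-split (suc zero)    s (suc a) = refl
+≡ᵇ-split (suc (suc x)) s (suc a) = +≡ᵇ-split (suc x) s a

hasContent-cons : ∀ {ℓ k} (w : Fin (suc ℓ) → ℕ) (a : Fin k → ℕ) c (f : Fin ℓ → Fin k) →
  hasContent w a (cons c f) ≡ (w zero ≤ᵇ a c) ∧ hasContent (λ j → w (suc j)) (lower c (w zero) a) f
hasContent-cons {ℓ} {k} w a c f =
  trans (andFin-cong k split) (andFin-extract k c (w zero ≤ᵇ a c) _)
  where
  rest : Fin k → ℕ
  rest = content (λ j → w (suc j)) f
  split : ∀ i → (((if ⌊ c ≟ i ⌋ then w zero else 0) + rest i) ≡ᵇ a i)
              ≡ (if ⌊ c ≟ i ⌋ then (w zero ≤ᵇ a c) else true) ∧ (rest i ≡ᵇ lower c (w zero) a i)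
  split i with c ≟ i
  ... | yes refl = +≡ᵇ-split (w zero) (rest c) (a c)
  ... | no  _    = refl

coeff-suc : ∀ ℓ k (w : Fin (suc ℓ) → ℕ) (a : Fin k → ℕ) →
  coeff (suc ℓ) k w a
    ≡ sumFin k (λ c → if w zero ≤ᵇ a c then coeff ℓ k (λ j → w (suc j)) (lower c (w zero) a) else 0)
coeff-suc ℓ k w a = begin
  countTrue (hasContent w a) (concatMap extensions (funs ℓ k))
    ≡⟨ countTrue-concatMap (hasContent w a) extensions (funs ℓ k) ⟩
  sum (map (λ f → countTrue (hasContent w a) (extensions f)) (funs ℓ k))
    ≡⟨ cong sum (map-cong byColour (funs ℓ k)) ⟩
  sum (map (λ f → sumFin k (λ c → 𝟙 (fits c ∧ hasContent w′ (lower c (w zero) a) f))) (funs ℓ k))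
    ≡⟨ countTrue-exchange k (λ c f → fits c ∧ hasContent w′ (lower c (w zero) a) f) (funs ℓ k) ⟩
  sumFin k (λ c → countTrue (λ f → fits c ∧ hasContent w′ (lower c (w zero) a) f) (funs ℓ k))
    ≡⟨ sumFin-cong k (λ c → countTrue-guard (fits c) (hasContent w′ (lower c (w zero) a)) (funs ℓ k)) ⟩
  sumFin k (λ c → if fits c then coeff ℓ k w′ (lower c (w zero) a) else 0)
    ∎
  where
  open ≡-Reasoning
  w′ : Fin ℓ → ℕ
  w′ j = w (suc j)
  fits : Fin k → Bool
  fits c = w zero ≤ᵇ a c
  extensions : (Fin ℓ → Fin k) → List (Fin (suc ℓ) → Fin k)
  extensions f = map (λ c → cons c f) (allFin k)
  byColour : ∀ f → countTrue (hasContent w a) (extensions f)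
                 ≡ sumFin k (λ c → 𝟙 (fits c ∧ hasContent w′ (lower c (w zero) a) f))
  byColour f = trans (countTrue-map-tabulate (hasContent w a) (λ c → cons c f) k (λ c → c))
                     (sumFin-cong k (λ c → cong 𝟙 (hasContent-cons w a c f)))

hasContent⇒content : ∀ {ℓ k} (w : Fin ℓ → ℕ) (a : Fin k → ℕ) (f : Fin ℓ → Fin k) →
  hasContent w a f ≡ true → ∀ i → content w f i ≡ a i
hasContent⇒content {k = k} w a f has i = ≡ᵇ⇒≡ _ _ (Equivalence.from T-≡ (andFin-true⁻¹ k _ has i))

content⇒hasContent : ∀ {ℓ k} (w : Fin ℓ → ℕ) (a : Fin k → ℕ) (f : Fin ℓ → Fin k) →
  (∀ i → content w f i ≡ a i) → hasContent w a f ≡ true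
content⇒hasContent {k = k} w a f eq = andFin-true k (λ i → Equivalence.to T-≡ (≡⇒≡ᵇ _ _ (eq i)))

withHead : ∀ {k} → ℕ → ℕ → (Fin k → ℕ) → Fin (suc (suc k)) → ℕ
withHead x y β zero          = x
withHead x y β (suc zero)    = y
withHead x y β (suc (suc i)) = β i

-- A coefficient function F "cancels" if for every tail β the coefficients of
-- x₁² x^β, x₂² x^β and x₁x₂ x^β satisfy [x₁²] + [x₂²] = [x₁x₂]; this is the
-- vanishing of the t²-coefficient of F(t, -t, x₃, …) - F(0, 0, x₃, …).
Cancels : ∀ {k} → ((Fin (suc (suc k)) → ℕ) → ℕ) → Set
Cancels F = ∀ β → F (withHead 2 0 β) + F (withHead 0 2 β) ≡ F (withHead 1 1 β)

lower-colour₀ : ∀ {k} x y (β : Fin k → ℕ) v i → lower zero v (withHead x y β) i ≡ withHead (x ∸ v) y β i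
lower-colour₀ x y β v zero          = refl
lower-colour₀ x y β v (suc zero)    = refl
lower-colour₀ x y β v (suc (suc i)) = refl

lower-colour₁ : ∀ {k} x y (β : Fin k → ℕ) v i → lower (suc zero) v (withHead x y β) i ≡ withHead x (y ∸ v) β i
lower-colour₁ x y β v zero          = refl
lower-colour₁ x y β v (suc zero)    = refl
lower-colour₁ x y β v (suc (suc i)) = refl

lower-tail : ∀ {k} x y (β : Fin k → ℕ) v c i →
  lower (suc (suc c)) v (withHead x y β) i ≡ withHead x y (lower c v β) i
lower-tail x y β v c zero          = refl
lower-tail x y β v c (suc zero)    = refl
lower-tail x y β v c (suc (suc i)) rewrite suc≟suc (suc c) (suc i) | suc≟suc c i = refl

-- Colours c ≥ 2 cancel by hypothesis; for v ≥ 3 colours 0 and 1 contribute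
-- nothing, while for v = 1 they contribute N(1,0,β) and N(0,1,β) on both sides.
module OddFactor {k : ℕ} (N : (Fin (suc (suc k)) → ℕ) → ℕ)
                 (N-cong : ∀ {a b} → (∀ i → a i ≡ b i) → N a ≡ N b)
                 (N-cancels : Cancels N) where

  expand : ℕ → (Fin (suc (suc k)) → ℕ) → ℕ
  expand v a = sumFin (suc (suc k)) (λ c → if v ≤ᵇ a c then N (lower c v a) else 0)

  tailPart : ℕ → (Fin (suc (suc k)) → ℕ) → ℕ
  tailPart v a = sumFin k (λ i → if v ≤ᵇ a (suc (suc i)) then N (lower (suc (suc i)) v a) else 0)

  tail-cancels : ∀ v β → tailPart v (withHead 2 0 β) + tailPart v (withHead 0 2 β) ≡ tailPart v (withHead 1 1 β)
  tail-cancels v β = trans (sym (sumFin-+ k _ _)) (sumFin-cong k atColour)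
    where
    term : ℕ → ℕ → Fin k → ℕ
    term x y i = if v ≤ᵇ β i then N (lower (suc (suc i)) v (withHead x y β)) else 0
    atColour : ∀ i → term 2 0 i + term 0 2 i ≡ term 1 1 i
    atColour i with v ≤ᵇ β i
    ... | false = refl
    ... | true  = begin
      N (lower (suc (suc i)) v (withHead 2 0 β)) + N (lower (suc (suc i)) v (withHead 0 2 β))
        ≡⟨ cong₂ _+_ (N-cong (lower-tail 2 0 β v i)) (N-cong (lower-tail 0 2 β v i)) ⟩
      N (withHead 2 0 (lower i v β)) + N (withHead 0 2 (lower i v β))
        ≡⟨ N-cancels (lower i v β) ⟩
      N (withHead 1 1 (lower i v β))
        ≡⟨ N-cong (lower-tail 1 1 β v i) ⟨
      N (lower (suc (suc i)) v (withHead 1 1 β))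
        ∎
      where open ≡-Reasoning

  expand-cancels : ∀ v → Odd v → Cancels (expand v)
  expand-cancels zero                () β
  expand-cancels (suc (suc zero))    () β
  expand-cancels (suc (suc (suc v))) _  β = tail-cancels (suc (suc (suc v))) β
  expand-cancels (suc zero)          _  β = begin
    (N (lower zero 1 (withHead 2 0 β)) + (0 + T₂₀)) + (0 + (N (lower (suc zero) 1 (withHead 0 2 β)) + T₀₂))
      ≡⟨ cong₂ (λ a b → (a + T₂₀) + (b + T₀₂)) (N-cong (lower-colour₀ 2 0 β 1)) (N-cong (lower-colour₁ 0 2 β 1)) ⟩
    (A + T₂₀) + (B + T₀₂)
      ≡⟨ +-interchange A T₂₀ B T₀₂ ⟩
    (A + B) + (T₂₀ + T₀₂)
      ≡⟨ cong₂ _+_ (+-comm A B) (tail-cancels 1 β) ⟩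
    (B + A) + T₁₁
      ≡⟨ +-assoc B A T₁₁ ⟩
    B + (A + T₁₁)
      ≡⟨ cong₂ (λ b a → b + (a + T₁₁)) (N-cong (lower-colour₀ 1 1 β 1)) (N-cong (lower-colour₁ 1 1 β 1)) ⟨
    N (lower zero 1 (withHead 1 1 β)) + (N (lower (suc zero) 1 (withHead 1 1 β)) + T₁₁)
      ∎
    where
    open ≡-Reasoning
    A B T₂₀ T₀₂ T₁₁ : ℕ
    A = N (withHead 1 0 β)
    B = N (withHead 0 1 β)
    T₂₀ = tailPart 1 (withHead 2 0 β)
    T₀₂ = tailPart 1 (withHead 0 2 β)
    T₁₁ = tailPart 1 (withHead 1 1 β)

coeff-cancels : ∀ ℓ k (w : Fin ℓ → ℕ) → (∀ j → Odd (w j)) → Cancels (coeff ℓ (suc (suc k)) w)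
coeff-cancels zero    k w odd β = refl
coeff-cancels (suc ℓ) k w odd β = begin
  coeff (suc ℓ) _ w (withHead 2 0 β) + coeff (suc ℓ) _ w (withHead 0 2 β)
    ≡⟨ cong₂ _+_ (coeff-suc ℓ _ w (withHead 2 0 β)) (coeff-suc ℓ _ w (withHead 0 2 β)) ⟩
  expand (w zero) (withHead 2 0 β) + expand (w zero) (withHead 0 2 β)
    ≡⟨ expand-cancels (w zero) (odd zero) β ⟩
  expand (w zero) (withHead 1 1 β)
    ≡⟨ coeff-suc ℓ _ w (withHead 1 1 β) ⟨
  coeff (suc ℓ) _ w (withHead 1 1 β)
    ∎
  where
  open ≡-Reasoning
  w′ : Fin ℓ → ℕ
  w′ j = w (suc j)
  open OddFactor (coeff ℓ (suc (suc k)) w′) (coeff-cong ℓ _ w′)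
                 (coeff-cancels ℓ k w′ (λ j → odd (suc j)))

coprime-1 : ∀ m → Coprime m 1
coprime-1 m common = ∣1⇒≡1 (proj₂ common)

toℚ-normal : ∀ m → toℚ m ≡ mkℚ (ℤ.+ m) 0 (coprime-1 m)
toℚ-normal m = ℚP.normalize-coprime (coprime-1 m)

toℚ-+ : ∀ m n → toℚ (m + n) ≡ toℚ m +ℚ toℚ n
toℚ-+ m n = begin
  (ℤ.+ (m + n)) / 1
    ≡⟨ cong (_/ 1) (ℤ.pos-+ m n) ⟩
  ((ℤ.+ m) ℤ.+ (ℤ.+ n)) / 1
    ≡⟨ cong₂ (λ a b → (a ℤ.+ b) / 1) (sym (ℤ.*-identityʳ (ℤ.+ m))) (sym (ℤ.*-identityʳ (ℤ.+ n))) ⟩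
  mkℚ (ℤ.+ m) 0 (coprime-1 m) +ℚ mkℚ (ℤ.+ n) 0 (coprime-1 n)
    ≡⟨ cong₂ _+ℚ_ (toℚ-normal m) (toℚ-normal n) ⟨
  toℚ m +ℚ toℚ n
    ∎
  where open ≡-Reasoning

toℚ-injective : ∀ {m n} → toℚ m ≡ toℚ n → m ≡ n
toℚ-injective {m} {n} eq = ℤ.+-injective (cong ℚ.numerator (trans (sym (toℚ-normal m)) (trans eq (toℚ-normal n))))

ListCancels : (List ℕ → ℚ) → Set
ListCancels F = ∀ βs → F (2 ∷ 0 ∷ βs) +ℚ F (0 ∷ 2 ∷ βs) ≡ F (1 ∷ 1 ∷ βs)

lookup-withHead : ∀ x y (βs : List ℕ) i → lookup (x ∷ y ∷ βs) i ≡ withHead x y (lookup βs) i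
lookup-withHead x y βs zero          = refl
lookup-withHead x y βs (suc zero)    = refl
lookup-withHead x y βs (suc (suc i)) = refl

coeff-list-cancels : ∀ ℓ (w : Fin ℓ → ℕ) → (∀ j → Odd (w j)) → ∀ βs →
  let k = suc (suc (length βs)) in
  coeff ℓ k w (lookup (2 ∷ 0 ∷ βs)) + coeff ℓ k w (lookup (0 ∷ 2 ∷ βs)) ≡ coeff ℓ k w (lookup (1 ∷ 1 ∷ βs))
coeff-list-cancels ℓ w odd βs = begin
  coeff ℓ k w (lookup (2 ∷ 0 ∷ βs)) + coeff ℓ k w (lookup (0 ∷ 2 ∷ βs))
    ≡⟨ cong₂ _+_ (coeff-cong ℓ k w (lookup-withHead 2 0 βs)) (coeff-cong ℓ k w (lookup-withHead 0 2 βs)) ⟩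
  coeff ℓ k w (withHead 2 0 (lookup βs)) + coeff ℓ k w (withHead 0 2 (lookup βs))
    ≡⟨ coeff-cancels ℓ (length βs) w odd (lookup βs) ⟩
  coeff ℓ k w (withHead 1 1 (lookup βs))
    ≡⟨ coeff-cong ℓ k w (lookup-withHead 1 1 βs) ⟨
  coeff ℓ k w (lookup (1 ∷ 1 ∷ βs))
    ∎
  where
  open ≡-Reasoning
  k : ℕ
  k = suc (suc (length βs))

lookup-odd : ∀ {λs} → All Odd λs → ∀ j → Odd (lookup λs j)
lookup-odd (odd ∷ _)   zero    = odd
lookup-odd (_ ∷ odds) (suc j) = lookup-odd odds j

p-cancels : ∀ λs → All Odd λs → ListCancels (p λs)
p-cancels λs odds βs =
  trans (sym (toℚ-+ (coeffAt (2 ∷ 0 ∷ βs)) (coeffAt (0 ∷ 2 ∷ βs))))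
        (cong toℚ (coeff-list-cancels (length λs) (lookup λs) (lookup-odd odds) βs))
  where
  coeffAt : List ℕ → ℕ
  coeffAt α = coeff (length λs) (length α) (lookup λs) (lookup α)

combination : List (ℚ × List ℕ) → List ℕ → ℚ
combination terms α = foldr (λ t acc → (proj₁ t *ℚ p (proj₂ t) α) +ℚ acc) (toℚ 0) terms

combination-cancels : ∀ terms → All (λ t → All Odd (proj₂ t)) terms → ListCancels (combination terms)
combination-cancels []               []           βs = sym (toℚ-+ 0 0)
combination-cancels ((c , λs) ∷ ts) (odds ∷ oss) βs = begin
  (c *ℚ P₂₀ +ℚ S₂₀) +ℚ (c *ℚ P₀₂ +ℚ S₀₂)  ≡⟨ +ℚ-interchange (c *ℚ P₂₀) S₂₀ (c *ℚ P₀₂) S₀₂ ⟩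
  (c *ℚ P₂₀ +ℚ c *ℚ P₀₂) +ℚ (S₂₀ +ℚ S₀₂)  ≡⟨ cong (_+ℚ (S₂₀ +ℚ S₀₂)) (ℚP.*-distribˡ-+ c P₂₀ P₀₂) ⟨
  c *ℚ (P₂₀ +ℚ P₀₂) +ℚ (S₂₀ +ℚ S₀₂)       ≡⟨ cong₂ (λ x y → c *ℚ x +ℚ y) (p-cancels λs odds βs) (combination-cancels ts oss βs) ⟩
  c *ℚ p λs (1 ∷ 1 ∷ βs) +ℚ combination ts (1 ∷ 1 ∷ βs) ∎
  where
  open ≡-Reasoning
  P₂₀ P₀₂ S₂₀ S₀₂ : ℚ
  P₂₀ = p λs (2 ∷ 0 ∷ βs)
  P₀₂ = p λs (0 ∷ 2 ∷ βs)
  S₂₀ = combination ts (2 ∷ 0 ∷ βs)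
  S₀₂ = combination ts (0 ∷ 2 ∷ βs)

Γ-cancels : ∀ F → InΓ F → ListCancels F
Γ-cancels F (terms , odds , F≡) βs =
  trans (cong₂ _+ℚ_ (F≡ _) (F≡ _)) (trans (combination-cancels terms odds βs) (sym (F≡ _)))

ones : ∀ {n} → Fin n → ℕ
ones _ = 1

coeff-replicate : ∀ n k (a : Fin k → ℕ) →
  coeff (length (replicate n 1)) k (lookup (replicate n 1)) a ≡ coeff n k ones a
coeff-replicate zero    k a = refl
coeff-replicate (suc n) k a = begin
  coeff (suc (length (replicate n 1))) k (lookup (replicate (suc n) 1)) a
    ≡⟨ coeff-suc _ k (lookup (replicate (suc n) 1)) a ⟩
  sumFin k (λ c → if 1 ≤ᵇ a c then coeff (length (replicate n 1)) k (lookup (replicate n 1)) (lower c 1 a) else 0)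
    ≡⟨ sumFin-cong k (λ c → cong (λ m → if 1 ≤ᵇ a c then m else 0) (coeff-replicate n k (lower c 1 a))) ⟩
  sumFin k (λ c → if 1 ≤ᵇ a c then coeff n k ones (lower c 1 a) else 0)
    ≡⟨ coeff-suc n k ones a ⟨
  coeff (suc n) k ones a
    ∎
  where open ≡-Reasoning

replicate-odd : ∀ n → All Odd (replicate n 1)
replicate-odd zero    = []
replicate-odd (suc n) = refl ∷ replicate-odd n

edgeless-proper : ∀ {n k} (G : SimpleGraph n) → NoEdge G → (κ : Fin n → Fin k) → proper G κ ≡ true
edgeless-proper {n} G noEdge κ =
  andFin-true n (λ i → andFin-true n (λ j → cong (λ b → not (b ∧ ⌊ κ i ≟ κ j ⌋)) (noEdge i j)))

edgeless-InΓ : ∀ n (G : SimpleGraph n) → NoEdge G → InΓ (X G)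
edgeless-InΓ n G noEdge = ((toℚ 1 , replicate n 1) ∷ []) , (replicate-odd n ∷ []) , X≡p₁ⁿ
  where
  X≡p₁ⁿ : ∀ α → X G α ≡ (toℚ 1 *ℚ p (replicate n 1) α) +ℚ toℚ 0
  X≡p₁ⁿ α = begin
    toℚ (countTrue (λ κ → proper G κ ∧ hasContent ones (lookup α) κ) (funs n (length α)))
      ≡⟨ cong toℚ (countTrue-cong (λ κ → cong (_∧ hasContent ones (lookup α) κ) (edgeless-proper G noEdge κ)) (funs n (length α))) ⟩
    toℚ (coeff n (length α) ones (lookup α))
      ≡⟨ cong toℚ (coeff-replicate n (length α) (lookup α)) ⟨
    p (replicate n 1) α
      ≡⟨ ℚP.*-identityˡ _ ⟨
    toℚ 1 *ℚ p (replicate n 1) α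
      ≡⟨ ℚP.+-identityʳ _ ⟨
    (toℚ 1 *ℚ p (replicate n 1) α) +ℚ toℚ 0
      ∎
    where open ≡-Reasoning

edge-irreflexive : ∀ {n} (G : SimpleGraph n) {u v} → adj G u v ≡ true → ¬ u ≡ v
edge-irreflexive G {u} uv refl with trans (sym uv) (irrefl G u)
... | ()

proper-ext : ∀ {n k} (G : SimpleGraph n) {κ κ′ : Fin n → Fin k} → (∀ i → κ i ≡ κ′ i) → proper G κ ≡ proper G κ′
proper-ext {n} G κ≗κ′ =
  andFin-cong n (λ i → andFin-cong n (λ j → cong₂ (λ x y → not (adj G i j ∧ ⌊ x ≟ y ⌋)) (κ≗κ′ i) (κ≗κ′ j)))

monochromatic-edge : ∀ {n k} (G : SimpleGraph n) (κ : Fin n → Fin k) {u v} →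
  adj G u v ≡ true → κ u ≡ κ v → proper G κ ≡ false
monochromatic-edge {n} G κ {u} {v} uv κu≡κv = andFin-false n _ u (andFin-false n _ v clash)
  where
  clash : not (adj G u v ∧ ⌊ κ u ≟ κ v ⌋) ≡ false
  clash rewrite uv | κu≡κv | ≟-refl (κ v) = refl

injective-proper : ∀ {n k} (G : SimpleGraph n) (a : Fin k → ℕ) (κ : Fin n → Fin k) →
  (∀ c → a c ≤ 1) → hasContent ones a κ ≡ true → proper G κ ≡ true
injective-proper {n} G a κ a≤1 has = andFin-true n (λ i → andFin-true n (λ j → noClash i j))
  where
  noClash : ∀ i j → not (adj G i j ∧ ⌊ κ i ≟ κ j ⌋) ≡ true
  noClash i j with adj G i j in ij
  ... | false = refl
  ... | true with κ i ≟ κ j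
  ...   | no  _     = refl
  ...   | yes κi≡κj = ⊥-elim (2≰1 (≤-trans twoPoints (subst (_≤ 1) (sym contentκj) (a≤1 (κ j)))))
    where
    contentκj : content ones κ (κ j) ≡ a (κ j)
    contentκj = hasContent⇒content ones a κ has (κ j)
    twoPoints : 2 ≤ content ones κ (κ j)
    twoPoints = subst (_≤ content ones κ (κ j)) (cong₂ _+_ ati atj)
                      (twoTerms≤sumFin n (λ m → if ⌊ κ m ≟ κ j ⌋ then 1 else 0) (edge-irreflexive G ij))
      where
      ati : (if ⌊ κ i ≟ κ j ⌋ then 1 else 0) ≡ 1
      ati rewrite κi≡κj | ≟-refl (κ j) = refl
      atj : (if ⌊ κ j ≟ κ j ⌋ then 1 else 0) ≡ 1
      atj rewrite ≟-refl (κ j) = refl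
    2≰1 : ¬ 2 ≤ 1
    2≰1 (s≤s ())

-- Colourings of G of a given content (with k colours), split by properness.
-- The proper ones are counted by X_G: X G α = toℚ (properCount G (lookup α)).
properCount improperCount : ∀ {n k} (G : SimpleGraph n) → (Fin k → ℕ) → ℕ
properCount   {n} {k} G a = countTrue (λ κ → proper G κ ∧ hasContent ones a κ) (funs n k)
improperCount {n} {k} G a = countTrue (λ κ → not (proper G κ) ∧ hasContent ones a κ) (funs n k)

coeff-split : ∀ {n k} (G : SimpleGraph n) (a : Fin k → ℕ) → coeff n k ones a ≡ properCount G a + improperCount G a
coeff-split {n} {k} G a = countTrue-split (proper G) (hasContent ones a) (funs n k)

properCount-squarefree : ∀ {n k} (G : SimpleGraph n) (a : Fin k → ℕ) → (∀ c → a c ≤ 1) →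
  properCount G a ≡ coeff n k ones a
properCount-squarefree {n} {k} G a a≤1 = countTrue-cong onlyContent (funs n k)
  where
  onlyContent : ∀ κ → (proper G κ ∧ hasContent ones a κ) ≡ hasContent ones a κ
  onlyContent κ with hasContent ones a κ in has
  ... | false = ∧-zeroʳ (proper G κ)
  ... | true  = trans (∧-identityʳ (proper G κ)) (injective-proper G a κ a≤1 has)

-- Since p₁ⁿ cancels, cancellation of X_G at a squarefree tail βs forces every
-- colouring of content (2, 0, βs) to be proper.
cancellation-forces-proper : ∀ {n} (G : SimpleGraph n) βs → (∀ c → lookup βs c ≤ 1) →
  properCount G (lookup (2 ∷ 0 ∷ βs)) + properCount G (lookup (0 ∷ 2 ∷ βs)) ≡ properCount G (lookup (1 ∷ 1 ∷ βs)) →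
  improperCount G (lookup (2 ∷ 0 ∷ βs)) ≡ 0
cancellation-forces-proper {n} G βs βs≤1 cancels = m+n≡0⇒m≡0 I₂₀ (+-cancelˡ-≡ (P₂₀ + P₀₂) _ _ (begin
  (P₂₀ + P₀₂) + (I₂₀ + I₀₂)  ≡⟨ +-interchange P₂₀ P₀₂ I₂₀ I₀₂ ⟩
  (P₂₀ + I₂₀) + (P₀₂ + I₀₂)  ≡⟨ cong₂ _+_ (coeff-split G a₂₀) (coeff-split G a₀₂) ⟨
  C a₂₀ + C a₀₂              ≡⟨ coeff-list-cancels n ones (λ _ → refl) βs ⟩
  C a₁₁                      ≡⟨ properCount-squarefree G a₁₁ a₁₁≤1 ⟨
  properCount G a₁₁          ≡⟨ cancels ⟨
  P₂₀ + P₀₂                  ≡⟨ +-identityʳ (P₂₀ + P₀₂) ⟨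
  (P₂₀ + P₀₂) + 0            ∎))
  where
  open ≡-Reasoning
  k : ℕ
  k = suc (suc (length βs))
  a₂₀ a₀₂ a₁₁ : Fin k → ℕ
  a₂₀ = lookup (2 ∷ 0 ∷ βs)
  a₀₂ = lookup (0 ∷ 2 ∷ βs)
  a₁₁ = lookup (1 ∷ 1 ∷ βs)
  C : (Fin k → ℕ) → ℕ
  C = coeff n k ones
  P₂₀ P₀₂ I₂₀ I₀₂ : ℕ
  P₂₀ = properCount G a₂₀
  P₀₂ = properCount G a₀₂
  I₂₀ = improperCount G a₂₀
  I₀₂ = improperCount G a₀₂
  a₁₁≤1 : ∀ c → a₁₁ c ≤ 1
  a₁₁≤1 zero          = ≤-refl
  a₁₁≤1 (suc zero)    = ≤-refl
  a₁₁≤1 (suc (suc c)) = βs≤1 c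

-- For an edge uv, the colouring κ giving u and v the colour 0 and every other
-- vertex j its own colour 2 + j is improper and has content (2, 0, βs), where
-- the squarefree tail βs records which vertices lie off the edge.
module EdgeWitness {n} (G : SimpleGraph n) {u v : Fin n} (uv : adj G u v ≡ true) where

  onEdge : Fin n → Bool
  onEdge j = ⌊ j ≟ u ⌋ ∨ ⌊ j ≟ v ⌋

  offEdge : Fin n → ℕ
  offEdge j = if onEdge j then 0 else 1

  βs : List ℕ
  βs = tabulate offEdge

  L : ℕ
  L = length βs

  index : Fin n → Fin L
  index = cast (sym (length-tabulate offEdge))

  vertex : Fin L → Fin n
  vertex = cast (length-tabulate offEdge)

  index-vertex : ∀ c → index (vertex c) ≡ c
  index-vertex = cast-involutive (sym (length-tabulate offEdge)) (length-tabulate offEdge)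

  vertex-index : ∀ j → vertex (index j) ≡ j
  vertex-index = cast-involutive (length-tabulate offEdge) (sym (length-tabulate offEdge))

  index-≟ : ∀ j i → ⌊ index j ≟ index i ⌋ ≡ ⌊ j ≟ i ⌋
  index-≟ j i with j ≟ i
  ... | yes refl = ≟-refl (index j)
  ... | no  j≢i  = ≟-≢ (λ eq → j≢i (trans (sym (vertex-index j)) (trans (cong vertex eq) (vertex-index i))))

  κ : Fin n → Fin (suc (suc L))
  κ j = if onEdge j then zero else suc (suc (index j))

  βs≤1 : ∀ c → lookup βs c ≤ 1
  βs≤1 c = subst (λ c′ → lookup βs c′ ≤ 1) (index-vertex c)
                 (subst (_≤ 1) (sym (lookup-tabulate offEdge (vertex c))) (offEdge≤1 (vertex c)))
    where
    offEdge≤1 : ∀ j → offEdge j ≤ 1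
    offEdge≤1 j with onEdge j
    ... | true  = z≤n
    ... | false = ≤-refl

  atColour₀ : ∀ b₁ b₂ (x : Fin L) → ¬ (b₁ ≡ true × b₂ ≡ true) →
    𝟙 ⌊ (if b₁ ∨ b₂ then zero else suc (suc x)) ≟ zero ⌋ ≡ 𝟙 b₁ + 𝟙 b₂
  atColour₀ true  true  x notBoth = ⊥-elim (notBoth (refl , refl))
  atColour₀ true  false x notBoth = refl
  atColour₀ false true  x notBoth = refl
  atColour₀ false false x notBoth = refl

  atColour₁ : ∀ b (x : Fin L) → 𝟙 ⌊ (if b then zero else suc (suc x)) ≟ suc zero ⌋ ≡ 0
  atColour₁ true  x = refl
  atColour₁ false x rewrite suc≟suc (suc x) zero = refl

  atColourTail : ∀ b (x y : Fin L) → 𝟙 ⌊ (if b then zero else suc (suc x)) ≟ suc (suc y) ⌋ ≡ (if b then 0 else 𝟙 ⌊ x ≟ y ⌋)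
  atColourTail true  x y = refl
  atColourTail false x y rewrite suc≟suc (suc x) (suc y) | suc≟suc x y = refl

  content₀ : content ones κ zero ≡ 2
  content₀ = begin
    sumFin n (λ j → 𝟙 ⌊ κ j ≟ zero ⌋)
      ≡⟨ sumFin-cong n (λ j → atColour₀ ⌊ j ≟ u ⌋ ⌊ j ≟ v ⌋ (index j) (notBoth j)) ⟩
    sumFin n (λ j → 𝟙 ⌊ j ≟ u ⌋ + 𝟙 ⌊ j ≟ v ⌋)
      ≡⟨ sumFin-+ n _ _ ⟩
    sumFin n (λ j → 𝟙 ⌊ j ≟ u ⌋) + sumFin n (λ j → 𝟙 ⌊ j ≟ v ⌋)
      ≡⟨ cong₂ _+_ (sumFin-point n u 1) (sumFin-point n v 1) ⟩
    2 ∎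
    where
    open ≡-Reasoning
    notBoth : ∀ j → ¬ (⌊ j ≟ u ⌋ ≡ true × ⌊ j ≟ v ⌋ ≡ true)
    notBoth j (j≡u , j≡v) = edge-irreflexive G uv (trans (sym (≟-≡ j≡u)) (≟-≡ j≡v))

  content₁ : content ones κ (suc zero) ≡ 0
  content₁ = trans (sumFin-cong n (λ j → atColour₁ (onEdge j) (index j))) (sumFin-zero n)

  contentTail : ∀ i → content ones κ (suc (suc (index i))) ≡ offEdge i
  contentTail i = trans (sumFin-cong n atVertex) (sumFin-point n i (offEdge i))
    where
    onlyAt : ∀ j → (if onEdge j then 0 else 𝟙 ⌊ j ≟ i ⌋) ≡ (if ⌊ j ≟ i ⌋ then offEdge i else 0)
    onlyAt j with j ≟ i
    ... | yes refl = refl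
    ... | no  _ with onEdge j
    ...   | true  = refl
    ...   | false = refl
    atVertex : ∀ j → 𝟙 ⌊ κ j ≟ suc (suc (index i)) ⌋ ≡ (if ⌊ j ≟ i ⌋ then offEdge i else 0)
    atVertex j = trans (atColourTail (onEdge j) (index j) (index i))
                       (trans (cong (λ b → if onEdge j then 0 else 𝟙 b) (index-≟ j i)) (onlyAt j))

  κ-content : hasContent ones (lookup (2 ∷ 0 ∷ βs)) κ ≡ true
  κ-content = content⇒hasContent ones _ κ agrees
    where
    agrees : ∀ c → content ones κ c ≡ lookup (2 ∷ 0 ∷ βs) c
    agrees zero          = content₀
    agrees (suc zero)    = content₁
    agrees (suc (suc c)) = subst (λ c′ → content ones κ (suc (suc c′)) ≡ lookup βs c′) (index-vertex c)
                                  (trans (contentTail (vertex c)) (sym (lookup-tabulate offEdge (vertex c))))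

  κ-improper : proper G κ ≡ false
  κ-improper = monochromatic-edge G κ uv (trans (onEdge-zero u u-on) (sym (onEdge-zero v v-on)))
    where
    onEdge-zero : ∀ j → onEdge j ≡ true → κ j ≡ zero
    onEdge-zero j on rewrite on = refl
    u-on : onEdge u ≡ true
    u-on rewrite ≟-refl u = refl
    v-on : onEdge v ≡ true
    v-on rewrite ≟-refl v = ∨-zeroʳ ⌊ v ≟ u ⌋

  improper-exists : 1 ≤ improperCount G (lookup (2 ∷ 0 ∷ βs))
  improper-exists = countTrue-pos _ (funs n (suc (suc L))) (Any.map witness (funs-complete n _ κ))
    where
    witness : ∀ {f} → (∀ j → f j ≡ κ j) → (not (proper G f) ∧ hasContent ones (lookup (2 ∷ 0 ∷ βs)) f) ≡ true
    witness f≗κ rewrite proper-ext G f≗κ | hasContent-ext ones (lookup (2 ∷ 0 ∷ βs)) f≗κ | κ-improper | κ-content = refl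

edge-not-InΓ : ∀ {n} (G : SimpleGraph n) {u v} → adj G u v ≡ true → ¬ InΓ (X G)
edge-not-InΓ G uv inΓ = 1≰0 (subst (1 ≤_) noImproper improper-exists)
  where
  open EdgeWitness G uv
  X-cancels : properCount G (lookup (2 ∷ 0 ∷ βs)) + properCount G (lookup (0 ∷ 2 ∷ βs))
            ≡ properCount G (lookup (1 ∷ 1 ∷ βs))
  X-cancels = toℚ-injective (trans (toℚ-+ (properCount G (lookup (2 ∷ 0 ∷ βs))) (properCount G (lookup (0 ∷ 2 ∷ βs))))
                                   (Γ-cancels (X G) inΓ βs))
  noImproper : improperCount G (lookup (2 ∷ 0 ∷ βs)) ≡ 0
  noImproper = cancellation-forces-proper G βs βs≤1 X-cancels
  1≰0 : ¬ 1 ≤ 0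
  1≰0 ()

proposition3p4 : (n : ℕ) (G : SimpleGraph n) → NoEdge G ⇔ InΓ (X G)
proposition3p4 n G = mk⇔ (edgeless-InΓ n G) InΓ⇒edgeless
  where
  InΓ⇒edgeless : InΓ (X G) → NoEdge G
  InΓ⇒edgeless inΓ i j with adj G i j in ij
  ... | false = refl
  ... | true  = ⊥-elim (edge-not-InΓ G ij inΓ)
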